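{- Given a string $T$ of length $n$ and a string attractor $\Gamma$ of size $\gamma$ for $T$, one can build a collage system for $T$ of size $\mathcal{O}(\gamma\log(n/\gamma))$.
   Context: A string attractor of $T$ is a set $\Gamma\subseteq\{1,\dots,n\}$ such that every substring $T[i..j]$ has an occurrence $T[i'..j']=T[i..j]$ with $p\in[i',j']$ for some $p\in\Gamma$. A collage system is a finite acyclic set of rules, each defining a distinct nonterminal, of types $X\rightarrow a$ (terminal), $X\rightarrow AB$, $X\rightarrow R^{\ell}$ (repetition of $R$), and $X\rightarrow K[l..r]$ (substring of the expansion of $K$), with $A,B,R,K\ne X$; it generates the expansion of a starting nonterminal. Its size is the number of rules. -}

module Defs where

open import Data.Nat using (ℕ; zero; suc; _+_; _*_; _∸_; _≤_; _/_)
open import Data.Nat.Logarithm using (⌊log₂_⌋)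
open import Data.Fin using (Fin)
open import Data.List using (List; []; _∷_; _++_; take; drop; length; concat; replicate)
open import Data.List.Relation.Unary.All using (All)
open import Data.List.Relation.Unary.Unique.Propositional using (Unique)
open import Data.Vec using (Vec; lookup; _∷ʳ_) renaming ([] to []ᵥ)
open import Data.Product using (Σ; ∃; _×_; _,_)
open import Data.Unit using (⊤)
open import Relation.Binary.PropositionalEquality using (_≡_)

-- Strings are lists over an alphabet A; positions are 1-based.

-- T[i..j]  (meaningful for 1 ≤ i ≤ j ≤ |T|)
substr : {A : Set} → List A → ℕ → ℕ → List A
substr T i j = take (suc j ∸ i) (drop (i ∸ 1) T)

IsAttractor : {A : Set} → List A → List ℕ → Set
IsAttractor T Γ =
  Unique Γ ×
  All (λ p → 1 ≤ p × p ≤ length T) Γ ×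
  (∀ i j → 1 ≤ i → i ≤ j → j ≤ length T →
     Σ ℕ λ i' → Σ ℕ λ j' → Σ ℕ λ p →
       (p ∈ℕ Γ) × 1 ≤ i' × i' ≤ p × p ≤ j' × j' ≤ length T ×
       substr T i' j' ≡ substr T i j)
  where
  _∈ℕ_ : ℕ → List ℕ → Set
  p ∈ℕ Γ = Data.List.Relation.Unary.Any.Any (p ≡_) Γ
    where import Data.List.Relation.Unary.Any

-- Nonterminals are numbered 0,1,…,m-1 and the rule of
-- nonterminal k may only refer to nonterminals < k (a topological order:
-- this is exactly finiteness + acyclicity, and guarantees A,B,R,K ≠ X).

data Rule (A : Set) (k : ℕ) : Set where
  term : A → Rule A k
  cat  : Fin k → Fin k → Rule A k
  rep  : Fin k → ℕ → Rule A k
  sub  : Fin k → ℕ → ℕ → Rule A k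

data Collage (A : Set) : ℕ → Set where
  ∅   : Collage A 0
  _▷_ : ∀ {k} → Collage A k → Rule A k → Collage A (suc k)

expandRule : {A : Set} {k : ℕ} → Vec (List A) k → Rule A k → List A
expandRule e (term a)  = a ∷ []
expandRule e (cat x y) = lookup e x ++ lookup e y
expandRule e (rep x ℓ) = concat (replicate ℓ (lookup e x))
expandRule e (sub x l r) = substr (lookup e x) l r

expansions : {A : Set} {k : ℕ} → Collage A k → Vec (List A) k
expansions ∅        = []ᵥ
expansions (c ▷ ρ) = expansions c ∷ʳ expandRule (expansions c) ρ

RuleOK : {A : Set} {k : ℕ} → Vec (List A) k → Rule A k → Set
RuleOK e (term a)    = ⊤
RuleOK e (cat x y)   = ⊤
RuleOK e (rep x ℓ)   = 1 ≤ ℓ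
RuleOK e (sub x l r) = 1 ≤ l × l ≤ r × r ≤ length (lookup e x)

WellFormed : {A : Set} {k : ℕ} → Collage A k → Set
WellFormed ∅       = ⊤
WellFormed (c ▷ ρ) = WellFormed c × RuleOK (expansions c) ρ

Generates : {A : Set} {m : ℕ} → Collage A m → List A → Set
Generates {m = m} C T = WellFormed C × Σ (Fin m) λ S → lookup (expansions C) S ≡ T

-- ⌊log₂ (n / γ)⌋ (with γ = 0 mapped to 0; never used since γ ≥ 1 when n ≥ 1)
logRatio : ℕ → ℕ → ℕ
logRatio n zero    = 0
logRatio n (suc g) = ⌊log₂ (n / suc g) ⌋

-- Give every attractor position p a nonterminal for the window of radius s around p, for
-- s = 1, 2, 4, …, 2^K.  A substring of length at most s has, by the attractor property, an
-- occurrence containing some p ∈ Γ, and that occurrence lies inside the window of radius s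
-- around p: one substring rule derives it.  Hence the windows of radius 2s cost four rules per
-- position (two side pieces, two concatenations), and level 0 costs one terminal rule per
-- position.  With 2^K ≥ n/(2γ), T is the concatenation of 2γ pieces of length at most 2^K,
-- two rules each: in total γ + 4γK + 4γ ≤ 5γ(1 + K) rules, where K = ⌊log₂(n/γ)⌋.
module Submission where

open import Defs
open import Data.Nat
open import Data.Nat.Properties
open import Data.Nat.DivMod using (_/_; _%_; m≡m%n+[m/n]*n; m%n<n)
open import Data.Nat.Logarithm using (⌊log₂_⌋; ⌊log₂⌋-mono-≤; ⌊log₂[2^n]⌋≡n)
open import Data.Nat.Tactic.RingSolver using (solve-∀)
open import Data.Fin using (Fin; inject₁; fromℕ)
open import Data.List using (List; []; _∷_; _++_; take; drop; length)
open import Data.List.Properties using (length-take; length-drop; take-all; take-[]; drop-[]; take-take; ++-identityʳ)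
open import Data.List.Relation.Unary.All as All using (All; []; _∷_)
open import Data.List.Relation.Unary.Any using (Any)
open import Data.Vec using (Vec; lookup; _∷ʳ_) renaming ([] to []ᵥ; _∷_ to _∷ᵥ_)
open import Data.Product using (Σ; _×_; _,_; proj₁; proj₂)
open import Data.Sum using (_⊎_; inj₁; inj₂)
open import Data.Empty using (⊥-elim)
open import Data.Unit using (tt)
open import Relation.Nullary using (¬_; yes; no)
open import Relation.Binary.PropositionalEquality

-- xs[a..b) with 0-based, half-open bounds; Defs.substr xs (suc a) b reduces to it.
slice : {A : Set} → List A → ℕ → ℕ → List A
slice xs a b = take (b ∸ a) (drop a xs)

module _ {A : Set} where

  slice-[] : ∀ a b → slice ([] {A = A}) a b ≡ []
  slice-[] a b = trans (cong (take (b ∸ a)) (drop-[] a)) (take-[] (b ∸ a))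

  slice-empty : ∀ (xs : List A) {a b} → b ≤ a → slice xs a b ≡ []
  slice-empty xs {a} b≤a = cong (λ k → take k (drop a xs)) (m≤n⇒m∸n≡0 b≤a)

  length-slice : ∀ (xs : List A) a {b} → b ≤ length xs → length (slice xs a b) ≡ b ∸ a
  length-slice xs a {b} b≤n = begin
    length (slice xs a b)              ≡⟨ length-take (b ∸ a) (drop a xs) ⟩
    (b ∸ a) ⊓ length (drop a xs)       ≡⟨ cong ((b ∸ a) ⊓_) (length-drop a xs) ⟩
    (b ∸ a) ⊓ (length xs ∸ a)          ≡⟨ m≤n⇒m⊓n≡m (∸-monoˡ-≤ a b≤n) ⟩
    b ∸ a                              ∎
    where open ≡-Reasoning

  take-++-take-drop : ∀ m k (xs : List A) → take m xs ++ take k (drop m xs) ≡ take (m + k) xs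
  take-++-take-drop zero    k xs       = refl
  take-++-take-drop (suc m) zero    [] = refl
  take-++-take-drop (suc m) (suc k) [] = refl
  take-++-take-drop (suc m) k (x ∷ xs) = cong (x ∷_) (take-++-take-drop m k xs)

  slice-++ : ∀ (xs : List A) a b c → a ≤ b → b ≤ c → slice xs a b ++ slice xs b c ≡ slice xs a c
  slice-++ xs zero b c _ b≤c =
    trans (take-++-take-drop b (c ∸ b) xs) (cong (λ k → take k xs) (m+[n∸m]≡n b≤c))
  slice-++ [] (suc a) b c _ _
    rewrite slice-[] (suc a) b | slice-[] b c | slice-[] (suc a) c = refl
  slice-++ (x ∷ xs) (suc a) (suc b) (suc c) (s≤s a≤b) (s≤s b≤c) = slice-++ xs a b c a≤b b≤c

  slice-take : ∀ (xs : List A) i j b → j ≤ b → slice (take b xs) i j ≡ slice xs i j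
  slice-take xs zero j b j≤b = trans (take-take j b xs) (cong (λ k → take k xs) (m≤n⇒m⊓n≡m j≤b))
  slice-take []       (suc i) j       zero    _ = refl
  slice-take []       (suc i) j       (suc b) _ = refl
  slice-take (x ∷ xs) (suc i) zero    b       _ = refl
  slice-take (x ∷ xs) (suc i) (suc j) (suc b) (s≤s j≤b) = slice-take xs i j b j≤b

  slice-slice : ∀ (xs : List A) a i j b → a ≤ i → j ≤ b → slice (slice xs a b) (i ∸ a) (j ∸ a) ≡ slice xs i j
  slice-slice xs zero i j b _ j≤b = slice-take xs i j b j≤b
  slice-slice [] (suc a) i j b _ _ rewrite slice-[] (suc a) b
    = trans (slice-[] (i ∸ suc a) (j ∸ suc a)) (sym (slice-[] i j))
  slice-slice (x ∷ xs) (suc a) (suc i) zero b (s≤s a≤i) _ rewrite 0∸n≡0 (i ∸ a) = refl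
  slice-slice (x ∷ xs) (suc a) (suc i) (suc j) (suc b) (s≤s a≤i) (s≤s j≤b) = slice-slice xs a i j b a≤i j≤b

  singleton-slice : ∀ (xs : List A) x → x < length xs → Σ A λ c → slice xs x (suc x) ≡ c ∷ []
  singleton-slice (c ∷ xs) zero    _         = c , refl
  singleton-slice (c ∷ xs) (suc x) (s≤s x<n) = singleton-slice xs x x<n

lookup-∷ʳ-inject₁ : ∀ {X : Set} {k} (v : Vec X k) x (i : Fin k) → lookup (v ∷ʳ x) (inject₁ i) ≡ lookup v i
lookup-∷ʳ-inject₁ (y ∷ᵥ v) x Fin.zero    = refl
lookup-∷ʳ-inject₁ (y ∷ᵥ v) x (Fin.suc i) = lookup-∷ʳ-inject₁ v x i

lookup-∷ʳ-last : ∀ {X : Set} {k} (v : Vec X k) x → lookup (v ∷ʳ x) (fromℕ k) ≡ x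
lookup-∷ʳ-last []ᵥ      x = refl
lookup-∷ʳ-last (y ∷ᵥ v) x = lookup-∷ʳ-last v x

module _ {A : Set} where

  infix 4 _≼_

  data _≼_ {m} (C : Collage A m) : ∀ {m'} → Collage A m' → Set where
    ≼-refl : C ≼ C
    ≼-snoc : ∀ {m'} {C' : Collage A m'} → C ≼ C' → (ρ : Rule A m') → RuleOK (expansions C') ρ → C ≼ C' ▷ ρ

  ≼-trans : ∀ {m m' m''} {C : Collage A m} {C' : Collage A m'} {C'' : Collage A m''} → C ≼ C' → C' ≼ C'' → C ≼ C''
  ≼-trans e ≼-refl           = e
  ≼-trans e (≼-snoc e' ρ ok) = ≼-snoc (≼-trans e e') ρ ok

  WellFormed-≼ : ∀ {m m'} {C : Collage A m} {C' : Collage A m'} → C ≼ C' → WellFormed C → WellFormed C'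
  WellFormed-≼ ≼-refl          w = w
  WellFormed-≼ (≼-snoc e ρ ok) w = WellFormed-≼ e w , ok

  record Derives {m} (C : Collage A m) (s : List A) : Set where
    constructor derives
    field
      {nonterminal} : Fin m
      expands       : lookup (expansions C) nonterminal ≡ s

  -- No nonterminal of a well-formed collage expands to [], so the empty string is admitted separately.
  DerivesOrEmpty : ∀ {m} → Collage A m → List A → Set
  DerivesOrEmpty C s = s ≡ [] ⊎ Derives C s

  Derives-≼ : ∀ {m m'} {C : Collage A m} {C' : Collage A m'} {s} → C ≼ C' → Derives C s → Derives C' s
  Derives-≼ ≼-refl d = d
  Derives-≼ (≼-snoc {C' = C'} e ρ _) d with Derives-≼ e d
  ... | derives {X} eq = derives (trans (lookup-∷ʳ-inject₁ (expansions C') _ X) eq)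

  DerivesOrEmpty-≼ : ∀ {m m'} {C : Collage A m} {C' : Collage A m'} {s} → C ≼ C' → DerivesOrEmpty C s → DerivesOrEmpty C' s
  DerivesOrEmpty-≼ e (inj₁ s≡[]) = inj₁ s≡[]
  DerivesOrEmpty-≼ e (inj₂ d)    = inj₂ (Derives-≼ e d)

  Property : Set₁
  Property = ∀ {k} → Collage A k → Set

  record Extension {m} (C : Collage A m) (d : ℕ) (P : Property) : Set₁ where
    constructor extension
    field
      {size}  : ℕ
      result  : Collage A size
      extends : C ≼ result
      bounded : size ≤ m + d
      holds   : P result

  return : ∀ {m d} {C : Collage A m} {P : Property} → P C → Extension C d P
  return {m} {d} {C} p = extension C ≼-refl (m≤m+n m d) p

  _>>=_ : ∀ {m d e} {C : Collage A m} {P Q : Property} →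
          Extension C d P → (∀ {k} {C' : Collage A k} → C ≼ C' × P C' → Extension C' e Q) → Extension C (d + e) Q
  _>>=_ {m} {d} {e} (extension C' ext size≤ p) f with f (ext , p)
  ... | extension C'' ext' size'≤ q = extension C'' (≼-trans ext ext') bound q
    where bound = ≤-trans size'≤ (≤-trans (+-monoˡ-≤ e size≤) (≤-reflexive (+-assoc m d e)))

  _<$>_ : ∀ {m d} {C : Collage A m} {P Q : Property} → (∀ {k} {C' : Collage A k} → P C' → Q C') → Extension C d P → Extension C d Q
  f <$> extension C' ext size≤ p = extension C' ext size≤ (f p)

  relax : ∀ {m d e} {C : Collage A m} {P : Property} → d ≤ e → Extension C d P → Extension C e P
  relax {m} d≤e (extension C' ext size≤ p) = extension C' ext (≤-trans size≤ (+-monoʳ-≤ m d≤e)) p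

  addRule : ∀ {m} (C : Collage A m) (ρ : Rule A m) → RuleOK (expansions C) ρ →
            Extension C 1 (λ C' → Derives C' (expandRule (expansions C) ρ))
  addRule {m} C ρ ok =
    extension (C ▷ ρ) (≼-snoc ≼-refl ρ ok) (≤-reflexive (+-comm 1 m)) (derives (lookup-∷ʳ-last (expansions C) _))

  concatenate : ∀ {m} {C : Collage A m} {s t} → DerivesOrEmpty C s → DerivesOrEmpty C t →
                Extension C 1 (λ C' → DerivesOrEmpty C' (s ++ t))
  concatenate (inj₁ refl) dt = return dt
  concatenate {C = C} {s = s} (inj₂ ds) (inj₁ refl) = return (inj₂ (subst (Derives C) (sym (++-identityʳ s)) ds))
  concatenate {C = C} (inj₂ (derives {X} refl)) (inj₂ (derives {Y} refl)) = inj₂ <$> addRule C (cat X Y) tt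

[q∸s]∸[q∸[s+t]]≤t : ∀ q s t → (q ∸ s) ∸ (q ∸ (s + t)) ≤ t
[q∸s]∸[q∸[s+t]]≤t q s t = m≤n+o⇒m∸n≤o (q ∸ s) (q ∸ (s + t)) (m≤n+o⇒m∸n≤o q s q≤s+[[q∸[s+t]]+t])
  where
  q≤s+[[q∸[s+t]]+t] : q ≤ s + ((q ∸ (s + t)) + t)
  q≤s+[[q∸[s+t]]+t] = ≤-trans (m≤n+m∸n q (s + t))
    (≤-reflexive (trans (+-assoc s t _) (cong (s +_) (+-comm t (q ∸ (s + t))))))

m⊓[o+t]∸m⊓o≤t : ∀ m o t → m ⊓ (o + t) ∸ m ⊓ o ≤ t
m⊓[o+t]∸m⊓o≤t m o t = m≤n+o⇒m∸n≤o (m ⊓ (o + t)) (m ⊓ o)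
  (≤-trans (⊓-monoˡ-≤ (o + t) (m≤m+n m t)) (≤-reflexive (sym (+-distribʳ-⊓ t m o))))

window-bounds : ∀ {i p j s} → i < p → p ≤ j → j ≤ i + s → p ∸ s ≤ i × j ≤ p ∸ 1 + s
window-bounds {i} {p} {j} {s} i<p p≤j j≤i+s =
  m≤n+o⇒m∸n≤o p s (≤-trans p≤j (≤-trans j≤i+s (≤-reflexive (+-comm i s)))) ,
  ≤-trans j≤i+s (+-monoˡ-≤ s (∸-monoˡ-≤ 1 i<p))

no-empty-attractor : ∀ {A : Set} (T : List A) → 1 ≤ length T → ¬ IsAttractor T []
no-empty-attractor T 1≤n (_ , _ , occurs) with occurs 1 1 ≤-refl ≤-refl 1≤n
... | _ , _ , _ , () , _

module AttractorCollage {A : Set} (T : List A) (Γ : List ℕ) (attractor : IsAttractor T Γ) where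

  n γ : ℕ
  n = length T
  γ = length Γ

  -- the 1-based positions p-s+1 .. p+s-1, clipped to T
  window : ℕ → ℕ → List A
  window s p = slice T (p ∸ s) (n ⊓ (p ∸ 1 + s))

  Windows : ℕ → List ℕ → Property
  Windows s ps C = All (λ p → DerivesOrEmpty C (window s p)) ps

  Windows-≼ : ∀ {s ps m m'} {C : Collage A m} {C' : Collage A m'} → C ≼ C' → Windows s ps C → Windows s ps C'
  Windows-≼ e = All.map (DerivesOrEmpty-≼ e)

  InRange : List ℕ → Set
  InRange ps = All (λ p → 1 ≤ p × p ≤ n) ps

  Γ-inRange : InRange Γ
  Γ-inRange = proj₁ (proj₂ attractor)

  record OccursInWindow (s : ℕ) (u : List A) : Set where
    constructor occurrence
    field
      {centre} : ℕ
      centre∈Γ : Any (centre ≡_) Γ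
      from to  : ℕ
      from<to  : from < to
      to≤      : to ≤ length (window s centre)
      occurs   : slice (window s centre) from to ≡ u

  short-slice-occurs-in-window : ∀ s i j → i < j → j ≤ n → j ∸ i ≤ s → OccursInWindow s (slice T i j)
  short-slice-occurs-in-window s i j i<j j≤n j∸i≤s with proj₂ (proj₂ attractor) (suc i) j (s≤s z≤n) i<j j≤n
  ... | suc i' , j' , p , p∈Γ , _ , i'<p , p≤j' , j'≤n , same = record
    { centre = p ; centre∈Γ = p∈Γ ; from = i' ∸ a ; to = j' ∸ a
    ; from<to = ≤-trans (≤-reflexive (sym (+-∸-assoc 1 a≤i'))) (∸-monoˡ-≤ a (≤-trans i'<p p≤j'))
    ; to≤ = ≤-trans (∸-monoˡ-≤ a j'≤b) (≤-reflexive (sym (length-slice T a (m⊓n≤m n _))))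
    ; occurs = trans (slice-slice T a i' j' b a≤i' j'≤b) same
    }
    where
    a = p ∸ s
    b = n ⊓ (p ∸ 1 + s)
    same-length : j' ∸ i' ≡ j ∸ i
    same-length = trans (sym (length-slice T i' j'≤n)) (trans (cong length same) (length-slice T i j≤n))
    j'≤i'+s : j' ≤ i' + s
    j'≤i'+s = ≤-trans (m≤n+m∸n j' i') (+-monoʳ-≤ i' (≤-trans (≤-reflexive same-length) j∸i≤s))
    a≤i' : a ≤ i'
    a≤i' = proj₁ (window-bounds i'<p p≤j' j'≤i'+s)
    j'≤b : j' ≤ b
    j'≤b = ⊓-glb j'≤n (proj₂ (window-bounds i'<p p≤j' j'≤i'+s))

  deriveOccurrence : ∀ {s m u} {C : Collage A m} → Windows s Γ C → OccursInWindow s u →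
                     Extension C 1 (λ C' → DerivesOrEmpty C' u)
  deriveOccurrence {u = u} {C = C} ws (occurrence centre∈Γ from to from<to to≤ occurs) with All.lookup ws centre∈Γ
  ... | inj₁ empty = ⊥-elim (n≮0 (<-≤-trans from<to (subst (λ w → to ≤ length w) empty to≤)))
  ... | inj₂ (derives {X} X↦window) = fromSubstring <$> addRule C (sub X (suc from) to) (s≤s z≤n , from<to , to≤X)
    where
    to≤X : to ≤ length (lookup (expansions C) X)
    to≤X = subst (λ w → to ≤ length w) (sym X↦window) to≤
    fromSubstring : ∀ {k} {C' : Collage A k} →
                    Derives C' (slice (lookup (expansions C) X) from to) → DerivesOrEmpty C' u
    fromSubstring (derives Y↦) = inj₂ (derives (trans Y↦ (trans (cong (λ w → slice w from to) X↦window) occurs)))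

  deriveShortSlice : ∀ s {m} {C : Collage A m} → Windows s Γ C → ∀ i j → j ≤ n → j ∸ i ≤ s →
                     Extension C 1 (λ C' → DerivesOrEmpty C' (slice T i j))
  deriveShortSlice s ws i j j≤n j∸i≤s with i <? j
  ... | no  i≮j = return (inj₁ (slice-empty T (≮⇒≥ i≮j)))
  ... | yes i<j = deriveOccurrence ws (short-slice-occurs-in-window s i j i<j j≤n j∸i≤s)

  window-1 : ∀ x → x < n → window 1 (suc x) ≡ slice T x (suc x)
  window-1 x x<n = cong (slice T x) (trans (m≥n⇒m⊓n≡n (≤-trans (≤-reflexive (+-comm x 1)) x<n)) (+-comm x 1))

  radiusOneWindows : ∀ ps → InRange ps → ∀ {m} (C : Collage A m) → Extension C (length ps) (Windows 1 ps)
  radiusOneWindows [] _ C = return []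
  radiusOneWindows (zero ∷ ps) ((() , _) ∷ _) C
  radiusOneWindows (suc x ∷ ps) ((_ , x<n) ∷ inRange) C with singleton-slice T x x<n
  ... | c , slice≡[c] = relax (≤-reflexive (+-identityʳ (suc (length ps)))) do
    (_  , derives-c) ← addRule C (term c) tt
    (e , rest)       ← radiusOneWindows ps inRange _
    return (inj₂ (subst (Derives _) (sym (trans (window-1 x x<n) slice≡[c])) (Derives-≼ e derives-c)) ∷ rest)

  doubleWindows : ∀ s → 1 ≤ s → ∀ qs → InRange qs → ∀ {m} {C : Collage A m} → Windows s Γ C → Windows s qs C →
                  Extension C (4 * length qs) (Windows (s + s) qs)
  doubleWindows s 1≤s [] _ _ _ = return []
  doubleWindows s 1≤s (q ∷ qs) ((1≤q , q≤n) ∷ inRange) wΓ (wq ∷ wqs) = relax (≤-reflexive (count (length qs))) do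
    (e₁ , left)  ← deriveShortSlice s wΓ a₂ a₁ (≤-trans (m∸n≤m q s) q≤n) ([q∸s]∸[q∸[s+t]]≤t q s s)
    (e₂ , right) ← deriveShortSlice s (Windows-≼ {s} e₁ wΓ) b₁ b₂ (m⊓n≤m n _) right-short
    (e₃ , middle+right) ← concatenate (DerivesOrEmpty-≼ (≼-trans e₁ e₂) wq) right
    (e₄ , whole) ← concatenate (DerivesOrEmpty-≼ (≼-trans e₂ e₃) left) middle+right
    let e = ≼-trans e₁ (≼-trans e₂ (≼-trans e₃ e₄))
    (e₅ , rest)  ← doubleWindows s 1≤s qs inRange (Windows-≼ {s} e wΓ) (Windows-≼ {s} e wqs)
    return (subst (DerivesOrEmpty _) split (DerivesOrEmpty-≼ e₅ whole) ∷ rest)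
    where
    a₂ a₁ b₁ b₂ : ℕ
    a₂ = q ∸ (s + s)
    a₁ = q ∸ s
    b₁ = n ⊓ (q ∸ 1 + s)
    b₂ = n ⊓ (q ∸ 1 + (s + s))
    a₂≤a₁ : a₂ ≤ a₁
    a₂≤a₁ = ∸-monoʳ-≤ q (m≤m+n s s)
    a₁≤b₁ : a₁ ≤ b₁
    a₁≤b₁ = ⊓-glb (≤-trans (m∸n≤m q s) q≤n) (≤-trans (∸-monoʳ-≤ q 1≤s) (m≤m+n (q ∸ 1) s))
    b₁≤b₂ : b₁ ≤ b₂
    b₁≤b₂ = ⊓-monoʳ-≤ n (+-monoʳ-≤ (q ∸ 1) (m≤m+n s s))
    right-short : b₂ ∸ b₁ ≤ s
    right-short = subst (λ x → n ⊓ x ∸ b₁ ≤ s) (+-assoc (q ∸ 1) s s) (m⊓[o+t]∸m⊓o≤t n (q ∸ 1 + s) s)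
    split : slice T a₂ a₁ ++ (window s q ++ slice T b₁ b₂) ≡ window (s + s) q
    split = trans (cong (slice T a₂ a₁ ++_) (slice-++ T a₁ b₁ b₂ a₁≤b₁ b₁≤b₂))
                  (slice-++ T a₂ a₁ b₂ a₂≤a₁ (≤-trans a₁≤b₁ b₁≤b₂))
    count : ∀ ℓ → 1 + (1 + (1 + (1 + (4 * ℓ + 0)))) ≡ 4 * suc ℓ
    count = solve-∀

  windowsOfRadius2^ : ∀ k → Extension ∅ (γ + k * (4 * γ)) (Windows (2 ^ k) Γ)
  windowsOfRadius2^ zero = relax (≤-reflexive (sym (+-identityʳ γ))) (radiusOneWindows Γ Γ-inRange ∅)
  windowsOfRadius2^ (suc k) = relax (≤-reflexive (count γ k)) do
    (_ , ws) ← windowsOfRadius2^ k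
    (λ {_} {C} → subst (λ r → Windows r Γ C) (cong (2 ^ k +_) (sym (+-identityʳ (2 ^ k)))))
      <$> doubleWindows (2 ^ k) (m^n>0 2 k) Γ Γ-inRange ws ws
    where
    count : ∀ γ k → γ + k * (4 * γ) + 4 * γ ≡ γ + suc k * (4 * γ)
    count = solve-∀

  derivePrefix : ∀ S c {m} {C : Collage A m} → Windows S Γ C →
                 Extension C (c * 2) (λ C' → DerivesOrEmpty C' (slice T 0 (n ⊓ (c * S))))
  derivePrefix S zero    ws = return (inj₁ (slice-empty T (m⊓n≤n n 0)))
  derivePrefix S (suc c) ws = relax (≤-reflexive (+-comm (c * 2) 2)) do
    (e₁ , prefix) ← derivePrefix S c ws
    (e₂ , chunk)  ← deriveShortSlice S (Windows-≼ {S} e₁ ws) (n ⊓ (c * S)) (n ⊓ (S + c * S)) (m⊓n≤m n _) chunk-short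
    (λ {_} {C} → subst (DerivesOrEmpty C) (slice-++ T 0 (n ⊓ (c * S)) (n ⊓ (S + c * S)) z≤n (⊓-monoʳ-≤ n (m≤n+m (c * S) S))))
      <$> concatenate (DerivesOrEmpty-≼ e₂ prefix) chunk
    where
    chunk-short : n ⊓ (S + c * S) ∸ n ⊓ (c * S) ≤ S
    chunk-short = subst (λ x → n ⊓ x ∸ n ⊓ (c * S) ≤ S) (+-comm (c * S) S) (m⊓[o+t]∸m⊓o≤t n (c * S) S)

  collage : 1 ≤ n → ∀ K → n ≤ 2 * γ * 2 ^ K →
            Σ ℕ λ m → Σ (Collage A m) λ C → Generates C T × m ≤ 5 * γ * (1 + K)
  collage 1≤n K n≤ with windowsOfRadius2^ K
  ... | extension C₁ e₁ size₁≤ ws with derivePrefix (2 ^ K) (2 * γ) ws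
  ... | extension {m} C e size≤ prefix = m , C , (WellFormed-≼ (≼-trans e₁ e) tt , derives-T) , count
    where
    whole-T : slice T 0 (n ⊓ (2 * γ * 2 ^ K)) ≡ T
    whole-T = trans (cong (slice T 0) (m≤n⇒m⊓n≡m n≤)) (take-all n T ≤-refl)
    derives-T : Σ (Fin m) λ S → lookup (expansions C) S ≡ T
    derives-T with subst (DerivesOrEmpty C) whole-T prefix
    ... | inj₁ T≡[]            = ⊥-elim (n≮0 (subst (λ xs → 0 < length xs) T≡[] 1≤n))
    ... | inj₂ (derives {S} S↦T) = S , S↦T
    count : m ≤ 5 * γ * (1 + K)
    count = begin
      m                                      ≤⟨ size≤ ⟩
      _ + 2 * γ * 2                          ≤⟨ +-monoˡ-≤ (2 * γ * 2) size₁≤ ⟩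
      γ + K * (4 * γ) + 2 * γ * 2            ≤⟨ m≤m+n _ (K * γ) ⟩
      γ + K * (4 * γ) + 2 * γ * 2 + K * γ    ≡⟨ regroup γ K ⟩
      5 * γ * (1 + K)                        ∎
      where
      open ≤-Reasoning
      regroup : ∀ γ K → γ + K * (4 * γ) + 2 * γ * 2 + K * γ ≡ 5 * γ * (1 + K)
      regroup = solve-∀

n<2^[1+⌊log₂n⌋] : ∀ n → n < 2 ^ suc ⌊log₂ n ⌋
n<2^[1+⌊log₂n⌋] n with 2 ^ suc ⌊log₂ n ⌋ ≤? n
... | no  2^≰n = ≰⇒> 2^≰n
... | yes 2^≤n = ⊥-elim (1+n≰n (≤-trans (≤-reflexive (sym (⌊log₂[2^n]⌋≡n (suc ⌊log₂ n ⌋)))) (⌊log₂⌋-mono-≤ 2^≤n)))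

n≤2γ*2^logRatio : ∀ n g → n ≤ 2 * suc g * 2 ^ logRatio n (suc g)
n≤2γ*2^logRatio n g = begin
  n                                  ≡⟨ m≡m%n+[m/n]*n n (suc g) ⟩
  n % suc g + n / suc g * suc g      ≤⟨ +-monoˡ-≤ _ (<⇒≤ (m%n<n n (suc g))) ⟩
  suc (n / suc g) * suc g            ≤⟨ *-monoˡ-≤ (suc g) (n<2^[1+⌊log₂n⌋] (n / suc g)) ⟩
  2 * 2 ^ L * suc g                  ≡⟨ regroup (suc g) (2 ^ L) ⟩
  2 * suc g * 2 ^ L                  ∎
  where
  open ≤-Reasoning
  L = logRatio n (suc g)
  regroup : ∀ a b → 2 * b * a ≡ 2 * a * b
  regroup = solve-∀

theorem3p13 : Σ ℕ λ c → (A : Set) → (T : List A) → (Γ : List ℕ) → 1 ≤ length T → IsAttractor T Γ → Σ ℕ λ m → Σ (Collage A m) λ C → Generates C T × m ≤ c * length Γ * (1 + logRatio (length T) (length Γ))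
theorem3p13 = 5 , λ where
  A T []      1≤n attractor → ⊥-elim (no-empty-attractor T 1≤n attractor)
  A T (p ∷ Γ) 1≤n attractor →
    AttractorCollage.collage T (p ∷ Γ) attractor 1≤n (logRatio (length T) (length (p ∷ Γ))) (n≤2γ*2^logRatio (length T) (length Γ))
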